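{- Let $1\le k\le n$. The cycle-type partition of $V(n,k)$ is an equitable partition of the arrangement graph $A(n,k)$.
   Context: $[\ell]=\{1,\dots,\ell\}$. A $k$-permutation of $[n]$ is an injective map $\pi:[k]\to[n]$, written $(\pi(1),\dots,\pi(k))$; $V(n,k)$ is the set of all of them. The arrangement graph $A(n,k)$ has vertex set $V(n,k)$, with $\pi,\rho$ adjacent iff there is exactly one $i\in[k]$ with $\pi(i)\neq\rho(i)$. Every $k$-permutation decomposes uniquely into disjoint cycles (distinct $u_1,\dots,u_\ell\in[k]$, up to rotation, with $\pi(u_t)=u_{t+1}$ for $t<\ell$, $\pi(u_\ell)=u_1$) and paths (distinct $u_1,\dots,u_\ell\in[k]$ with $\pi(u_t)=u_{t+1}$ for $t<\ell$ and $\pi(u_\ell)\notin[k]$), whose elements in $[k]$ partition $[k]$. The cycle type of $\pi$ records, for each $\ell$, the number of cycles of length $\ell$ and the number of paths of length $\ell$ in this decomposition. The cycle-type partition of $V(n,k)$ is the partition into classes of $k$-permutations having the same cycle type. A partition $(V_1,\dots,V_m)$ of the vertex set of a graph is equitable if for all $i,j$ (possibly $i=j$) every vertex in $V_i$ has the same number of neighbours in $V_j$. -}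

module Defs where

open import Data.Nat using (ℕ; _≤_)
open import Data.Fin using (Fin; toℕ)
open import Data.Vec using (Vec; lookup)
open import Data.List using (List; map; concatMap; length; allFin)
open import Data.List.NonEmpty as L⁺ using (List⁺; head; last)
open import Data.List.Relation.Unary.All using (All)
open import Data.List.Relation.Unary.Linked using (Linked)
open import Data.List.Relation.Unary.Unique.Propositional using (Unique)
open import Data.List.Membership.Propositional using (_∈_)
open import Data.List.Relation.Binary.Permutation.Propositional using (_↭_)
open import Data.Product using (Σ; ∃; _×_)
open import Function.Bundles using (_⇔_)
open import Relation.Binary.PropositionalEquality using (_≡_; _≢_)

-- A k-permutation of [n] is represented as a vector (π(1),…,π(k)) of
-- elements of [n] = Fin n (0-indexed); V(n,k) = injective such vectors.
KPerm : ℕ → ℕ → Set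
KPerm n k = Vec (Fin n) k

IsKPerm : ∀ {n k} → KPerm n k → Set
IsKPerm {k = k} π = ∀ (i j : Fin k) → lookup π i ≡ lookup π j → i ≡ j

Adjacent : ∀ {n k} → KPerm n k → KPerm n k → Set
Adjacent {k = k} π ρ =
  Σ (Fin k) λ i → (lookup π i ≢ lookup ρ i) × (∀ j → lookup π j ≢ lookup ρ j → j ≡ i)

Step : ∀ {n k} → KPerm n k → Fin k → Fin k → Set
Step π u u' = toℕ (lookup π u) ≡ toℕ u'

data Kind : Set where
  cycle : Kind
  path  : Kind

record Block (k : ℕ) : Set where
  constructor block
  field
    kind  : Kind
    elems : List⁺ (Fin k)
open Block public

EndCond : ∀ {n k} → KPerm n k → Kind → List⁺ (Fin k) → Set
EndCond π cycle us = Step π (last us) (head us)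
EndCond {k = k} π path us = k ≤ toℕ (lookup π (last us))

ValidBlock : ∀ {n k} → KPerm n k → Block k → Set
ValidBlock π b = Linked (Step π) (L⁺.toList (elems b)) × EndCond π (kind b) (elems b)

Decomposition : ∀ {n k} → KPerm n k → Set
Decomposition {k = k} π =
  Σ (List (Block k)) λ bs →
    All (ValidBlock π) bs × (concatMap (λ b → L⁺.toList (elems b)) bs ↭ allFin k)

typeOf : ∀ {k} → List (Block k) → List (Kind × ℕ)
typeOf = map (λ b → kind b Data.Product., L⁺.length (elems b))

SameCycleType : ∀ {n k} → KPerm n k → KPerm n k → Set
SameCycleType π ρ =
  Σ (Decomposition π) λ D → Σ (Decomposition ρ) λ E →
    typeOf (Data.Product.proj₁ D) ↭ typeOf (Data.Product.proj₁ E)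

NeighboursInClass : ∀ {n k} → KPerm n k → KPerm n k → ℕ → Set
NeighboursInClass {n} {k} π τ m =
  Σ (List (KPerm n k)) λ xs →
    Unique xs ×
    (∀ ρ → (ρ ∈ xs) ⇔ (IsKPerm ρ × Adjacent π ρ × SameCycleType ρ τ)) ×
    length xs ≡ m

CycleTypePartitionEquitable : ℕ → ℕ → Set
CycleTypePartitionEquitable n k =
  (π σ τ : KPerm n k) → IsKPerm π → IsKPerm σ → IsKPerm τ →
  SameCycleType π σ →
  Σ ℕ λ m → NeighboursInClass π τ m × NeighboursInClass σ τ m

module Submission where

-- For permutations g of [n] and h of [k] such that g restricts to h on [k], the map ρ ↦ g ∘ ρ ∘ h⁻¹ is an
-- automorphism of A(n,k) sending each cycle or path (u₁,…,u_ℓ) of ρ to the cycle or path (h u₁,…,h u_ℓ),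
-- so it preserves every cycle-type class. If π and σ have the same cycle type, matching their blocks of
-- equal kind and length position by position gives h, and g extends h by sending π(u) to σ(h u) whenever
-- π(u) ∉ [k]; both families of prescribed values are injective, so such a g exists, and then g ∘ π = σ ∘ h.
-- The automorphism maps π to σ and the neighbours of π in a class bijectively onto those of σ. The number
-- of neighbours in a class exists because cycle type is decidable: a decomposition has at most k blocks
-- with at most k + 1 elements each, so it can be found by a finite search.

open import Defs
open import Data.Nat as ℕ using (ℕ; zero; suc; _≤_; _<_; z≤n; s≤s)
import Data.Nat.Properties as ℕ
open import Data.Fin as Fin using (Fin; toℕ; inject≤; fromℕ<)
open import Data.Vec as V using (Vec; lookup; tabulate)
import Data.Vec.Properties as Vec
import Data.Fin.Properties as Fin
open import Data.Fin.Permutation as Perm using (Permutation′; _⟨$⟩ʳ_; _⟨$⟩ˡ_; inverseˡ; inverseʳ; _∘ₚ_; transpose)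
import Data.Fin.Permutation.Components as PC
open import Data.List as List using (List; []; _∷_; _++_; map; concatMap; allFin; length; filter)
import Data.List.Properties as List
open import Data.List.NonEmpty as L⁺ using (List⁺; _∷_)
open import Data.List.Relation.Unary.All as All using (All; []; _∷_)
import Data.List.Relation.Unary.All.Properties as All
open import Data.List.Relation.Unary.Any as Any using (Any; here; there; any?)
open import Data.List.Relation.Unary.Linked as Linked using (Linked; _∷_)
import Data.List.Relation.Unary.Linked.Properties as LinkedP
open import Data.List.Relation.Unary.Unique.Propositional using (Unique; _∷_)
import Data.List.Relation.Unary.Unique.Propositional.Properties as Unique
import Data.List.Relation.Unary.Unique.DecPropositional.Properties as Unique
open import Data.List.Relation.Binary.Pointwise using (Pointwise; []; _∷_)
open import Data.List.Relation.Binary.Subset.Propositional using (_⊆_)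
open import Data.List.Relation.Binary.Disjoint.Propositional using (Disjoint)
open import Data.List.Membership.Propositional using (_∈_; lose)
open import Data.List.Membership.Propositional.Properties using (∈-∃++; ∈-++⁻; ∈-map⁺; ∈-map⁻; ∈-allFin; ∈-cartesianProductWith⁺; ∈-cartesianProduct⁺; ∈-filter⁺; ∈-filter⁻; ∈-deduplicate⁺; ∈-deduplicate⁻)
open import Data.List.Relation.Binary.Permutation.Propositional using (_↭_; ↭-refl; ↭-sym; ↭-trans; prep; swap; refl; trans; ↭⇒↭ₛ)
import Data.List.Relation.Binary.Permutation.Propositional.Properties as ↭
open import Data.List.Relation.Binary.Permutation.Propositional.Properties using (¬x∷xs↭[]; ∈-resp-↭; shift; shifts; drop-mid; ++⁺ˡ)
import Data.List.Relation.Binary.Permutation.Setoid.Properties as Permutationₛ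
open import Data.Product using (Σ; ∃; _×_; _,_; proj₁; proj₂)
import Data.Product.Properties as Product
open import Data.Sum using (_⊎_; inj₁; inj₂)
open import Data.Empty using (⊥-elim)
open import Function using (_∘_; _$_)
open import Function.Bundles using (mk⇔; Equivalence)
open import Relation.Nullary using (Dec; yes; no)
open import Relation.Nullary.Decidable as Dec using (dec-true; dec-false; _×-dec_; _→-dec_; ¬?)
open import Relation.Binary.Definitions using (Decidable; DecidableEquality)
open import Relation.Binary.PropositionalEquality as ≡ using (_≡_; _≢_; refl; sym; cong; cong₂; subst; subst₂; module ≡-Reasoning)

module _ {A : Set} where

  ↭-dec : DecidableEquality A → Decidable (_↭_ {A = A})
  ↭-dec _≟_ []       []       = yes ↭-refl
  ↭-dec _≟_ []       (y ∷ ys) = no (λ p → ¬x∷xs↭[] (↭-sym p))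
  ↭-dec _≟_ (x ∷ xs) ys with any? (x ≟_) ys
  ... | no x∉ys = no (λ p → x∉ys (∈-resp-↭ p (here refl)))
  ... | yes x∈ys with l , r , refl ← ∈-∃++ x∈ys with ↭-dec _≟_ xs (l ++ r)
  ...   | yes p = yes (↭-trans (prep x p) (↭-sym (shift x l r)))
  ...   | no ¬p = no (λ q → ¬p (drop-mid [] l q))

  Unique-resp-↭ : {xs ys : List A} → xs ↭ ys → Unique xs → Unique ys
  Unique-resp-↭ p = Permutationₛ.Unique-resp-↭ (≡.setoid A) (↭⇒↭ₛ p)

  Unique-⊆-⊇⇒↭ : {xs ys : List A} → Unique xs → Unique ys → xs ⊆ ys → ys ⊆ xs → xs ↭ ys
  Unique-⊆-⊇⇒↭ {[]}     {[]}     _ _ _ _ = ↭-refl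
  Unique-⊆-⊇⇒↭ {[]}     {y ∷ ys} _ _ _ ys⊆xs with () ← ys⊆xs (here refl)
  Unique-⊆-⊇⇒↭ {x ∷ xs} (x∉xs ∷ xs!) ys! xs⊆ys ys⊆xs
    with l , r , refl ← ∈-∃++ (xs⊆ys (here refl))
    with x∉lr ∷ lr! ← Unique-resp-↭ (shift x l r) ys!
    = ↭-trans (prep x (Unique-⊆-⊇⇒↭ xs! lr! xs⊆lr lr⊆xs)) (↭-sym (shift x l r))
    where
    xs⊆lr : xs ⊆ l ++ r
    xs⊆lr v∈xs with ∈-resp-↭ (shift x l r) (xs⊆ys (there v∈xs))
    ... | here refl = ⊥-elim (All.lookup x∉xs v∈xs refl)
    ... | there v∈lr = v∈lr
    lr⊆xs : l ++ r ⊆ xs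
    lr⊆xs v∈lr with ys⊆xs (∈-resp-↭ (↭-sym (shift x l r)) (there v∈lr))
    ... | here refl = ⊥-elim (All.lookup x∉lr v∈lr refl)
    ... | there v∈xs = v∈xs

module _ {A B : Set} (f : A → List B) where

  concatMap⁺ : {xs ys : List A} → xs ↭ ys → concatMap f xs ↭ concatMap f ys
  concatMap⁺ refl         = ↭-refl
  concatMap⁺ (prep x p)   = ++⁺ˡ (f x) (concatMap⁺ p)
  concatMap⁺ (swap x y p) = ↭-trans (shifts (f x) (f y)) (++⁺ˡ (f y) (++⁺ˡ (f x) (concatMap⁺ p)))
  concatMap⁺ (trans p q)  = ↭-trans (concatMap⁺ p) (concatMap⁺ q)

module _ {A B : Set} {R : A → B → Set} where

  Pointwise-++⁻ : ∀ {ws xs ys zs} → length ws ≡ length ys →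
                  Pointwise R (ws ++ xs) (ys ++ zs) → Pointwise R ws ys × Pointwise R xs zs
  Pointwise-++⁻ {[]}    {ys = []}    _  rs       = [] , rs
  Pointwise-++⁻ {_ ∷ _} {ys = _ ∷ _} eq (r ∷ rs) =
    let ps , qs = Pointwise-++⁻ (ℕ.suc-injective eq) rs in r ∷ ps , qs

  Pointwise-map⇒∈ : ∀ {C : Set} {f : C → A} {g : C → B} {cs c} →
                    Pointwise R (map f cs) (map g cs) → c ∈ cs → R (f c) (g c)
  Pointwise-map⇒∈ {cs = _ ∷ _} (r ∷ _)  (here refl) = r
  Pointwise-map⇒∈ {cs = _ ∷ _} (_ ∷ rs) (there c∈cs) = Pointwise-map⇒∈ rs c∈cs

module _ {A : Set} where

  -- L⁺.last is computed through a snoc view, so even this unfolding step needs a proof.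
  last-∷ : (x y : A) (ys : List A) → L⁺.last (x ∷ y ∷ ys) ≡ L⁺.last (y ∷ ys)
  last-∷ x y ys = ≡.trans (last≡lastFrom x (y ∷ ys)) (sym (last≡lastFrom y ys))
    where
    lastFrom : A → List A → A
    lastFrom x []       = x
    lastFrom _ (y ∷ ys) = lastFrom y ys

    lastFrom-∷ʳ : ∀ x ys y → lastFrom x (ys List.∷ʳ y) ≡ y
    lastFrom-∷ʳ x []       y = refl
    lastFrom-∷ʳ x (z ∷ ys) y = lastFrom-∷ʳ z ys y

    last≡lastFrom : ∀ x xs → L⁺.last (x ∷ xs) ≡ lastFrom x xs
    last≡lastFrom x xs with List.initLast xs
    ... | []            = refl
    ... | ys List.∷ʳ′ y = sym (lastFrom-∷ʳ x ys y)

module _ {A B : Set} where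

  last-map : (f : A → B) (xs : List⁺ A) → L⁺.last (L⁺.map f xs) ≡ f (L⁺.last xs)
  last-map f (x ∷ xs) = go x xs
    where
    go : ∀ x xs → L⁺.last (f x ∷ map f xs) ≡ f (L⁺.last (x ∷ xs))
    go x []       = refl
    go x (y ∷ ys) = begin
      L⁺.last (f x ∷ f y ∷ map f ys) ≡⟨ last-∷ (f x) (f y) (map f ys) ⟩
      L⁺.last (f y ∷ map f ys)       ≡⟨ go y ys ⟩
      f (L⁺.last (y ∷ ys))           ≡⟨ cong f (last-∷ x y ys) ⟨
      f (L⁺.last (x ∷ y ∷ ys))       ∎
      where open ≡-Reasoning

  Pointwise-last : {R : A → B → Set} {xs : List⁺ A} {ys : List⁺ B} →
                   Pointwise R (L⁺.toList xs) (L⁺.toList ys) → R (L⁺.last xs) (L⁺.last ys)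
  Pointwise-last {R} {x ∷ xs} {y ∷ ys} = go
    where
    go : ∀ {x xs y ys} → Pointwise R (x ∷ xs) (y ∷ ys) → R (L⁺.last (x ∷ xs)) (L⁺.last (y ∷ ys))
    go (r ∷ [])                                  = r
    go {x} {x′ ∷ xs} {y} {y′ ∷ ys} (_ ∷ r′ ∷ rs) =
      subst₂ R (sym (last-∷ x x′ xs)) (sym (last-∷ y y′ ys)) (go (r′ ∷ rs))

Vec-ext : ∀ {A : Set} {m} {u v : Vec A m} → (∀ i → lookup u i ≡ lookup v i) → u ≡ v
Vec-ext {u = u} {v} e = ≡.trans (sym (Vec.tabulate∘lookup u)) (≡.trans (Vec.tabulate-cong e) (Vec.tabulate∘lookup v))

-- Extending a partial injection to a permutation

⟨$⟩ʳ-injective : ∀ {n} (g : Permutation′ n) {x y} → g ⟨$⟩ʳ x ≡ g ⟨$⟩ʳ y → x ≡ y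
⟨$⟩ʳ-injective g {x} {y} e = ≡.trans (sym (inverseˡ g)) (≡.trans (cong (g ⟨$⟩ˡ_) e) (inverseˡ g))

map-permutation-allFin : ∀ {k} (h : Permutation′ k) → map (h ⟨$⟩ʳ_) (allFin k) ↭ allFin k
map-permutation-allFin h = Unique-⊆-⊇⇒↭ (Unique.map⁺ (⟨$⟩ʳ-injective h) (Unique.allFin⁺ _)) (Unique.allFin⁺ _)
  (λ _ → ∈-allFin _) (λ {v} _ → subst (_∈ _) (inverseʳ h) (∈-map⁺ _ (∈-allFin (h ⟨$⟩ˡ v))))

Sends : ∀ {n} → Permutation′ n → Fin n → Fin n → Set
Sends g x y = g ⟨$⟩ʳ x ≡ y

extendToPermutation : ∀ {n} {xs ys : List (Fin n)} → Unique xs → Unique ys → length xs ≡ length ys →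
                      Σ (Permutation′ n) λ g → Pointwise (Sends g) xs ys
extendToPermutation {xs = []}    {[]}    _ _ _ = Perm.id , []
extendToPermutation {xs = x ∷ _} {y ∷ _} (x∉xs ∷ xs!) (y∉ys ∷ ys!) eq
  with f , f-sends ← extendToPermutation xs! ys! (ℕ.suc-injective eq)
  = f ∘ₚ transpose (f ⟨$⟩ʳ x) y , transpose-matchˡ {i = f ⟨$⟩ʳ x} ∷ transpose-elsewhere x∉xs y∉ys f-sends
  where
  transpose-matchˡ : ∀ {n} {i j : Fin n} → PC.transpose i j i ≡ j
  transpose-matchˡ {i = i} rewrite dec-true (i Fin.≟ i) refl = refl

  transpose-other : ∀ {n} {i j k : Fin n} → k ≢ i → k ≢ j → PC.transpose i j k ≡ k
  transpose-other {i = i} {j} {k} k≢i k≢j rewrite dec-false (k Fin.≟ i) k≢i | dec-false (k Fin.≟ j) k≢j = refl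

  transpose-elsewhere : ∀ {xs ys} → All (x ≢_) xs → All (y ≢_) ys → Pointwise (Sends f) xs ys →
                        Pointwise (Sends (f ∘ₚ transpose (f ⟨$⟩ʳ x) y)) xs ys
  transpose-elsewhere [] [] [] = []
  transpose-elsewhere (x≢x′ ∷ ps) (y≢y′ ∷ qs) (fx′≡y′ ∷ rs) =
    ≡.trans (transpose-other (λ e → x≢x′ (sym (⟨$⟩ʳ-injective f e))) (λ e → y≢y′ (≡.trans (sym e) fx′≡y′))) fx′≡y′
    ∷ transpose-elsewhere ps qs rs

-- Relabelling k-permutations

Exits : ∀ {n k} → KPerm n k → Fin k → Set
Exits {k = k} ρ u = k ≤ toℕ (lookup ρ u)

members : ∀ {k} → Block k → List (Fin k)
members b = L⁺.toList (elems b)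

relabelBlock : ∀ {k} → Permutation′ k → Block k → Block k
relabelBlock h (block κ us) = block κ (L⁺.map (h ⟨$⟩ʳ_) us)

IsDecomposition : ∀ {n k} → KPerm n k → List (Block k) → Set
IsDecomposition {k = k} ρ bs = All (ValidBlock ρ) bs × concatMap members bs ↭ allFin k

IsDecomposition-resp-↭ : ∀ {n k} {ρ : KPerm n k} {bs bs′} → bs ↭ bs′ → IsDecomposition ρ bs → IsDecomposition ρ bs′
IsDecomposition-resp-↭ bs↭bs′ (valid , covers) =
  ↭.All-resp-↭ bs↭bs′ valid , ↭-trans (concatMap⁺ members (↭-sym bs↭bs′)) covers

module _ {k} (h : Permutation′ k) where

  members-relabelBlocks : ∀ bs → concatMap members (map (relabelBlock h) bs) ≡ map (h ⟨$⟩ʳ_) (concatMap members bs)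
  members-relabelBlocks bs = begin
    concatMap members (map (relabelBlock h) bs) ≡⟨ List.concatMap-map members (relabelBlock h) bs ⟩
    concatMap (members ∘ relabelBlock h) bs     ≡⟨ List.concatMap-cong members-relabelBlock bs ⟩
    concatMap (map (h ⟨$⟩ʳ_) ∘ members) bs      ≡⟨ List.map-concatMap (h ⟨$⟩ʳ_) members bs ⟨
    map (h ⟨$⟩ʳ_) (concatMap members bs)        ∎
    where
    open ≡-Reasoning
    members-relabelBlock : ∀ b → members (relabelBlock h b) ≡ map (h ⟨$⟩ʳ_) (members b)
    members-relabelBlock (block _ (_ ∷ _)) = refl

  typeOf-relabelBlocks : ∀ bs → typeOf (map (relabelBlock h) bs) ≡ typeOf bs
  typeOf-relabelBlocks bs = ≡.trans (sym (List.map-∘ bs)) (List.map-cong kind-length-relabelBlock bs)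
    where
    kind-length-relabelBlock : ∀ b → (kind (relabelBlock h b) , L⁺.length (elems (relabelBlock h b)))
                                     ≡ (kind b , L⁺.length (elems b))
    kind-length-relabelBlock (block κ (_ ∷ xs)) = cong (λ l → κ , suc l) (List.length-map _ xs)

record Relabelling (n k : ℕ) : Set where
  field
    outer     : Permutation′ n
    inner     : Permutation′ k
    restricts : ∀ i x → toℕ i ≡ toℕ x → toℕ (outer ⟨$⟩ʳ i) ≡ toℕ (inner ⟨$⟩ʳ x)

open Relabelling

relabel : ∀ {n k} → Relabelling n k → KPerm n k → KPerm n k
relabel r ρ = tabulate (λ i → outer r ⟨$⟩ʳ lookup ρ (inner r ⟨$⟩ˡ i))

inverse : ∀ {n k} → k ≤ n → Relabelling n k → Relabelling n k
inverse k≤n r = record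
  { outer     = Perm.flip (outer r)
  ; inner     = Perm.flip (inner r)
  ; restricts = λ i x i≈x → ≡.trans (cong toℕ (outer⁻¹-restricts i x i≈x)) (Fin.toℕ-inject≤ _ k≤n)
  }
  where
  outer⁻¹-restricts : ∀ i x → toℕ i ≡ toℕ x → outer r ⟨$⟩ˡ i ≡ inject≤ (inner r ⟨$⟩ˡ x) k≤n
  outer⁻¹-restricts i x i≈x = begin
    outer r ⟨$⟩ˡ i                            ≡⟨ cong (outer r ⟨$⟩ˡ_) (Fin.toℕ-injective lifted) ⟨
    outer r ⟨$⟩ˡ (outer r ⟨$⟩ʳ inject≤ y k≤n) ≡⟨ inverseˡ (outer r) ⟩
    inject≤ y k≤n                             ∎
    where
    open ≡-Reasoning
    y = inner r ⟨$⟩ˡ x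
    lifted : toℕ (outer r ⟨$⟩ʳ inject≤ y k≤n) ≡ toℕ i
    lifted = ≡.trans (restricts r _ y (Fin.toℕ-inject≤ y k≤n)) (≡.trans (cong toℕ (inverseʳ (inner r))) (sym i≈x))

module _ {n k} (r : Relabelling n k) where

  lookup-relabel : ∀ ρ i → lookup (relabel r ρ) i ≡ outer r ⟨$⟩ʳ lookup ρ (inner r ⟨$⟩ˡ i)
  lookup-relabel ρ i = Vec.lookup∘tabulate _ i

  lookup-relabel-inner : ∀ ρ u → lookup (relabel r ρ) (inner r ⟨$⟩ʳ u) ≡ outer r ⟨$⟩ʳ lookup ρ u
  lookup-relabel-inner ρ u = ≡.trans (lookup-relabel ρ _) (cong (λ v → outer r ⟨$⟩ʳ lookup ρ v) (inverseˡ (inner r)))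

  relabel-isKPerm : ∀ {ρ} → IsKPerm ρ → IsKPerm (relabel r ρ)
  relabel-isKPerm {ρ} ρ-inj i j e = begin
    i                               ≡⟨ inverseʳ (inner r) ⟨
    inner r ⟨$⟩ʳ (inner r ⟨$⟩ˡ i)   ≡⟨ cong (inner r ⟨$⟩ʳ_) (ρ-inj _ _ (⟨$⟩ʳ-injective (outer r) e′)) ⟩
    inner r ⟨$⟩ʳ (inner r ⟨$⟩ˡ j)   ≡⟨ inverseʳ (inner r) ⟩
    j                               ∎
    where
    open ≡-Reasoning
    e′ = ≡.trans (sym (lookup-relabel ρ i)) (≡.trans e (lookup-relabel ρ j))

  relabel-adjacent : ∀ {π ρ} → Adjacent π ρ → Adjacent (relabel r π) (relabel r ρ)
  relabel-adjacent {π} {ρ} (i , πi≢ρi , only-i) = inner r ⟨$⟩ʳ i , differs , only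
    where
    differs : lookup (relabel r π) (inner r ⟨$⟩ʳ i) ≢ lookup (relabel r ρ) (inner r ⟨$⟩ʳ i)
    differs e = πi≢ρi (⟨$⟩ʳ-injective (outer r)
      (≡.trans (sym (lookup-relabel-inner π i)) (≡.trans e (lookup-relabel-inner ρ i))))
    only : ∀ j → lookup (relabel r π) j ≢ lookup (relabel r ρ) j → j ≡ inner r ⟨$⟩ʳ i
    only j πj≢ρj = ≡.trans (sym (inverseʳ (inner r))) (cong (inner r ⟨$⟩ʳ_) (only-i _ λ e →
      πj≢ρj (≡.trans (lookup-relabel π j) (≡.trans (cong (outer r ⟨$⟩ʳ_) e) (sym (lookup-relabel ρ j))))))

  relabel-step : ∀ {ρ u u′} → Step ρ u u′ → Step (relabel r ρ) (inner r ⟨$⟩ʳ u) (inner r ⟨$⟩ʳ u′)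
  relabel-step {ρ} {u} {u′} s = ≡.trans (cong toℕ (lookup-relabel-inner ρ u)) (restricts r _ u′ s)

  outer-outside : k ≤ n → ∀ {i} → k ≤ toℕ i → k ≤ toℕ (outer r ⟨$⟩ʳ i)
  outer-outside k≤n {i} k≤i = ℕ.≮⇒≥ λ gi<k → ℕ.<⇒≱ (returns gi<k) k≤i
    where
    returns : toℕ (outer r ⟨$⟩ʳ i) < k → toℕ i < k
    returns gi<k = subst (_< k) i≈x (Fin.toℕ<n (inner r ⟨$⟩ˡ fromℕ< gi<k))
      where
      i≈x : toℕ (inner r ⟨$⟩ˡ fromℕ< gi<k) ≡ toℕ i
      i≈x = ≡.trans (sym (restricts (inverse k≤n r) _ _ (sym (Fin.toℕ-fromℕ< gi<k))))
                    (cong toℕ (inverseˡ (outer r)))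

  relabel-endCond : k ≤ n → ∀ {ρ} κ us → EndCond ρ κ us → EndCond (relabel r ρ) κ (L⁺.map (inner r ⟨$⟩ʳ_) us)
  relabel-endCond _ {ρ} cycle us s =
    subst (λ v → Step (relabel r ρ) v _) (sym (last-map (inner r ⟨$⟩ʳ_) us)) (relabel-step {ρ} s)
  relabel-endCond k≤n {ρ} path us e =
    subst (Exits (relabel r ρ)) (sym (last-map (inner r ⟨$⟩ʳ_) us))
      (subst (λ j → k ≤ toℕ j) (sym (lookup-relabel-inner ρ _)) (outer-outside k≤n e))

  relabel-validBlock : k ≤ n → ∀ {ρ} b → ValidBlock ρ b → ValidBlock (relabel r ρ) (relabelBlock (inner r) b)
  relabel-validBlock k≤n {ρ} (block κ (x ∷ xs)) (linked , end) =
    LinkedP.map⁺ (Linked.map (relabel-step {ρ}) linked) , relabel-endCond k≤n κ (x ∷ xs) end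

  relabel-isDecomposition : k ≤ n → ∀ {ρ bs} → IsDecomposition ρ bs →
                            IsDecomposition (relabel r ρ) (map (relabelBlock (inner r)) bs)
  relabel-isDecomposition k≤n {bs = bs} (valid , covers) =
    All.map⁺ (All.map (relabel-validBlock k≤n _) valid) ,
    subst (_↭ allFin k) (sym (members-relabelBlocks (inner r) bs))
      (↭-trans (↭.map⁺ (inner r ⟨$⟩ʳ_) covers) (map-permutation-allFin (inner r)))

  relabel-sameCycleType : k ≤ n → ∀ {ρ τ} → SameCycleType ρ τ → SameCycleType (relabel r ρ) τ
  relabel-sameCycleType k≤n ((bs , d) , E , types) =
    (_ , relabel-isDecomposition k≤n d) , E , subst (_↭ typeOf (proj₁ E)) (sym (typeOf-relabelBlocks (inner r) bs)) types

module _ {n k} (k≤n : k ≤ n) (r : Relabelling n k) where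

  relabel-inverseˡ : ∀ ρ → relabel (inverse k≤n r) (relabel r ρ) ≡ ρ
  relabel-inverseˡ ρ = Vec-ext λ i → ≡.trans (lookup-relabel (inverse k≤n r) (relabel r ρ) i) $
    ≡.trans (cong (outer r ⟨$⟩ˡ_) (lookup-relabel-inner r ρ i)) (inverseˡ (outer r))

  relabel-inverseʳ : ∀ ρ → relabel r (relabel (inverse k≤n r) ρ) ≡ ρ
  relabel-inverseʳ ρ = Vec-ext λ i → ≡.trans (lookup-relabel r (relabel (inverse k≤n r) ρ) i) $
    ≡.trans (cong (outer r ⟨$⟩ʳ_) (lookup-relabel-inner (inverse k≤n r) ρ i)) (inverseʳ (outer r))

  neighboursInClass-relabel : ∀ {π τ m} → NeighboursInClass π τ m → NeighboursInClass (relabel r π) τ m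
  neighboursInClass-relabel {π} {τ} (xs , xs! , ∈xs⇔ , |xs|≡m) =
    map (relabel r) xs , Unique.map⁺ relabel-injective xs! , (λ ρ → mk⇔ to from) , ≡.trans (List.length-map _ xs) |xs|≡m
    where
    r⁻¹ = inverse k≤n r

    relabel-injective : ∀ {ρ ρ′} → relabel r ρ ≡ relabel r ρ′ → ρ ≡ ρ′
    relabel-injective {ρ} {ρ′} e =
      ≡.trans (sym (relabel-inverseˡ ρ)) (≡.trans (cong (relabel r⁻¹) e) (relabel-inverseˡ ρ′))

    to : ∀ {ρ} → ρ ∈ map (relabel r) xs → IsKPerm ρ × Adjacent (relabel r π) ρ × SameCycleType ρ τ
    to ρ∈ with ρ′ , ρ′∈xs , refl ← ∈-map⁻ _ ρ∈ with inj , adj , same ← Equivalence.to (∈xs⇔ ρ′) ρ′∈xs =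
      relabel-isKPerm r {ρ′} inj , relabel-adjacent r {π} {ρ′} adj , relabel-sameCycleType r k≤n {ρ′} same

    from : ∀ {ρ} → IsKPerm ρ × Adjacent (relabel r π) ρ × SameCycleType ρ τ → ρ ∈ map (relabel r) xs
    from {ρ} (inj , adj , same) = subst (_∈ map (relabel r) xs) (relabel-inverseʳ ρ) (∈-map⁺ _ (Equivalence.from (∈xs⇔ _)
      (relabel-isKPerm r⁻¹ {ρ} inj ,
       subst (λ π′ → Adjacent π′ (relabel r⁻¹ ρ)) (relabel-inverseˡ π) (relabel-adjacent r⁻¹ {relabel r π} {ρ} adj) ,
       relabel-sameCycleType r⁻¹ k≤n {ρ} same)))

-- Deciding cycle type by finite search

listsUpTo : ∀ {A : Set} → ℕ → List A → List (List A)
listsUpTo zero    xs = [] ∷ []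
listsUpTo (suc m) xs = [] ∷ List.cartesianProductWith _∷_ xs (listsUpTo m xs)

∈-listsUpTo : ∀ {A : Set} {m} {xs ys : List A} → length ys ≤ m → All (_∈ xs) ys → ys ∈ listsUpTo m xs
∈-listsUpTo {m = zero}  {ys = []}    _         _            = here refl
∈-listsUpTo {m = suc m} {ys = []}    _         _            = here refl
∈-listsUpTo {m = suc m} {ys = _ ∷ _} (s≤s len) (y∈xs ∷ ys⊆xs) =
  there (∈-cartesianProductWith⁺ _∷_ y∈xs (∈-listsUpTo len ys⊆xs))

vectors : ∀ n k → List (Vec (Fin n) k)
vectors n zero    = V.[] ∷ []
vectors n (suc k) = List.cartesianProductWith V._∷_ (allFin n) (vectors n k)

∈-vectors : ∀ {n k} (v : Vec (Fin n) k) → v ∈ vectors n k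
∈-vectors V.[]       = here refl
∈-vectors (x V.∷ v) = ∈-cartesianProductWith⁺ V._∷_ (∈-allFin x) (∈-vectors v)

_≟-kind_ : DecidableEquality Kind
cycle ≟-kind cycle = yes refl
cycle ≟-kind path  = no λ ()
path  ≟-kind cycle = no λ ()
path  ≟-kind path  = yes refl

module _ {k : ℕ} where

  blocksUpTo : List (Block k)
  blocksUpTo = List.cartesianProductWith block (cycle ∷ path ∷ [])
                 (List.cartesianProductWith _∷_ (allFin k) (listsUpTo k (allFin k)))

  ∈-blocksUpTo : (b : Block k) → length (L⁺.tail (elems b)) ≤ k → b ∈ blocksUpTo
  ∈-blocksUpTo (block κ (x ∷ t)) len =
    ∈-cartesianProductWith⁺ block (∈-kinds κ)
      (∈-cartesianProductWith⁺ _∷_ (∈-allFin x) (∈-listsUpTo len (All.tabulate λ {y} _ → ∈-allFin y)))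
    where
    ∈-kinds : ∀ κ → κ ∈ cycle ∷ path ∷ []
    ∈-kinds cycle = here refl
    ∈-kinds path  = there (here refl)

  length≤length-members : (bs : List (Block k)) → length bs ≤ length (concatMap members bs)
  length≤length-members []                      = z≤n
  length≤length-members (block _ (_ ∷ t) ∷ bs) =
    s≤s (ℕ.≤-trans (length≤length-members bs) (List.length-++-≤ʳ (concatMap members bs) {t}))

  tail≤length-members : ∀ {b} (bs : List (Block k)) → b ∈ bs → length (L⁺.tail (elems b)) ≤ length (concatMap members bs)
  tail≤length-members (block _ (_ ∷ t) ∷ bs) (here refl) = ℕ.m≤n⇒m≤1+n (List.length-++-≤ˡ t)
  tail≤length-members (block _ (_ ∷ t) ∷ bs) (there b∈bs) =
    ℕ.m≤n⇒m≤1+n (ℕ.≤-trans (tail≤length-members bs b∈bs) (List.length-++-≤ʳ (concatMap members bs) {t}))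

  candidates : List (List (Block k))
  candidates = listsUpTo k blocksUpTo

  ∈-candidates : (bs : List (Block k)) → concatMap members bs ↭ allFin k → bs ∈ candidates
  ∈-candidates bs covers = ∈-listsUpTo (subst (length bs ≤_) total (length≤length-members bs))
    (All.tabulate λ {b} b∈bs → ∈-blocksUpTo b (subst (_ ≤_) total (tail≤length-members bs b∈bs)))
    where
    total : length (concatMap members bs) ≡ k
    total = ≡.trans (↭.↭-length covers) (List.length-tabulate (λ i → i))

module _ {n k : ℕ} where

  step? : (ρ : KPerm n k) → ∀ u u′ → Dec (Step ρ u u′)
  step? ρ u u′ = toℕ (lookup ρ u) ℕ.≟ toℕ u′

  endCond? : (ρ : KPerm n k) → ∀ κ us → Dec (EndCond ρ κ us)
  endCond? ρ cycle us = step? ρ (L⁺.last us) (L⁺.head us)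
  endCond? ρ path  us = k ℕ.≤? toℕ (lookup ρ (L⁺.last us))

  validBlock? : (ρ : KPerm n k) → ∀ b → Dec (ValidBlock ρ b)
  validBlock? ρ (block κ us) = Linked.linked? (step? ρ) (L⁺.toList us) ×-dec endCond? ρ κ us

  isDecomposition? : ∀ ρ bs → Dec (IsDecomposition ρ bs)
  isDecomposition? ρ bs = All.all? (validBlock? ρ) bs ×-dec ↭-dec Fin._≟_ (concatMap members bs) (allFin k)

  sameCycleType? : (ρ τ : KPerm n k) → Dec (SameCycleType ρ τ)
  sameCycleType? ρ τ = Dec.map′ witness search (any? matching? (List.cartesianProduct candidates candidates))
    where
    Matching : List (Block k) × List (Block k) → Set
    Matching (bs , cs) = IsDecomposition ρ bs × IsDecomposition τ cs × typeOf bs ↭ typeOf cs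

    matching? : ∀ p → Dec (Matching p)
    matching? (bs , cs) = isDecomposition? ρ bs ×-dec isDecomposition? τ cs ×-dec
                          ↭-dec (Product.≡-dec _≟-kind_ ℕ._≟_) (typeOf bs) (typeOf cs)

    witness : Any Matching (List.cartesianProduct candidates candidates) → SameCycleType ρ τ
    witness found with (bs , cs) , dρ , dτ , t ← Any.satisfied found = (bs , dρ) , (cs , dτ) , t

    search : SameCycleType ρ τ → Any Matching (List.cartesianProduct candidates candidates)
    search ((bs , dρ) , (cs , dτ) , t) =
      lose (∈-cartesianProduct⁺ (∈-candidates bs (proj₂ dρ)) (∈-candidates cs (proj₂ dτ))) (dρ , dτ , t)

  isKPerm? : (ρ : KPerm n k) → Dec (IsKPerm ρ)
  isKPerm? ρ = Fin.all? λ i → Fin.all? λ j → (lookup ρ i Fin.≟ lookup ρ j) →-dec (i Fin.≟ j)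

  adjacent? : (π ρ : KPerm n k) → Dec (Adjacent π ρ)
  adjacent? π ρ = Fin.any? λ i → ¬? (lookup π i Fin.≟ lookup ρ i) ×-dec
                                Fin.all? λ j → ¬? (lookup π j Fin.≟ lookup ρ j) →-dec (j Fin.≟ i)

  neighboursInClass : (π τ : KPerm n k) → Σ ℕ (NeighboursInClass π τ)
  neighboursInClass π τ = length xs , xs , Unique.deduplicate-! (Vec.≡-dec Fin._≟_) ys , (λ ρ → mk⇔ sound complete) , refl
    where
    P : KPerm n k → Set
    P ρ = IsKPerm ρ × Adjacent π ρ × SameCycleType ρ τ
    P? : ∀ ρ → Dec (P ρ)
    P? ρ = isKPerm? ρ ×-dec adjacent? π ρ ×-dec sameCycleType? ρ τ
    ys = filter P? (vectors n k)
    xs = List.deduplicate (Vec.≡-dec Fin._≟_) ys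
    sound : ∀ {ρ} → ρ ∈ xs → P ρ
    sound ρ∈xs = proj₂ (∈-filter⁻ P? {xs = vectors n k} (∈-deduplicate⁻ (Vec.≡-dec Fin._≟_) ys ρ∈xs))
    complete : ∀ {ρ} → P ρ → ρ ∈ xs
    complete {ρ} p = ∈-deduplicate⁺ (Vec.≡-dec Fin._≟_) (∈-filter⁺ P? {xs = vectors n k} (∈-vectors ρ) p)

-- k-permutations of the same cycle type are relabellings of each other

Intertwines : ∀ {n k} → Permutation′ k → KPerm n k → KPerm n k → Fin k → Set
Intertwines h π σ u = (∃ λ u′ → Step π u u′ × Step σ (h ⟨$⟩ʳ u) (h ⟨$⟩ʳ u′)) ⊎ (Exits π u × Exits σ (h ⟨$⟩ʳ u))

module _ {n k} {h : Permutation′ k} {π σ : KPerm n k} where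

  linked-intertwines : ∀ {x xs y ys} → Pointwise (Sends h) (x ∷ xs) (y ∷ ys) →
                       Linked (Step π) (x ∷ xs) → Linked (Step σ) (y ∷ ys) →
                       Intertwines h π σ (L⁺.last (x ∷ xs)) → ∀ {u} → u ∈ x ∷ xs → Intertwines h π σ u
  linked-intertwines (_ ∷ [])        _            _            at-last (here refl) = at-last
  linked-intertwines (hx ∷ hx′ ∷ hs) (πx ∷ πlink) (σy ∷ σlink) at-last (here refl) =
    inj₁ (_ , πx , subst₂ (Step σ) (sym hx) (sym hx′) σy)
  linked-intertwines {x} {x′ ∷ xs} (_ ∷ hs) (_ ∷ πlink) (_ ∷ σlink) at-last (there u∈) =
    linked-intertwines hs πlink σlink (subst (Intertwines h π σ) (last-∷ x x′ xs) at-last) u∈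

  block-intertwines : ∀ b c → kind b ≡ kind c → Pointwise (Sends h) (members b) (members c) →
                      ValidBlock π b → ValidBlock σ c → ∀ {u} → u ∈ members b → Intertwines h π σ u
  block-intertwines (block cycle (x ∷ xs)) (block cycle (y ∷ ys)) refl hs@(hx ∷ _) (πlink , πend) (σlink , σend) =
    linked-intertwines hs πlink σlink
      (inj₁ (x , πend , subst₂ (Step σ) (sym (Pointwise-last {xs = x ∷ xs} {y ∷ ys} hs)) (sym hx) σend))
  block-intertwines (block path (x ∷ xs)) (block path (y ∷ ys)) refl hs (πlink , πend) (σlink , σend) =
    linked-intertwines hs πlink σlink
      (inj₂ (πend , subst (Exits σ) (sym (Pointwise-last {xs = x ∷ xs} {y ∷ ys} hs)) σend))

  blocks-intertwine : ∀ bs cs → typeOf bs ≡ typeOf cs → All (ValidBlock π) bs → All (ValidBlock σ) cs →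
                      Pointwise (Sends h) (concatMap members bs) (concatMap members cs) →
                      ∀ {u} → u ∈ concatMap members bs → Intertwines h π σ u
  blocks-intertwine (b ∷ bs) (c ∷ cs) types (πb ∷ πbs) (σc ∷ σcs) hs u∈
    with same-type , types′ ← List.∷-injective types
    with hs-b , hs-bs ← Pointwise-++⁻ (cong proj₂ same-type) hs
    with ∈-++⁻ (members b) u∈
  ... | inj₁ u∈b  = block-intertwines b c (cong proj₁ same-type) hs-b πb σc u∈b
  ... | inj₂ u∈bs = blocks-intertwine bs cs types′ πbs σcs hs-bs u∈bs

module _ {n k} {π σ : KPerm n k} where

  innerMatching : ∀ {bs cs} → IsDecomposition π bs → IsDecomposition σ cs → typeOf bs ≡ typeOf cs →
                  Σ (Permutation′ k) λ h → ∀ u → Intertwines h π σ u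
  innerMatching {bs} {cs} (πvalid , πcovers) (σvalid , σcovers) types
    with h , hs ← extendToPermutation (Unique-resp-↭ (↭-sym πcovers) (Unique.allFin⁺ k))
                                      (Unique-resp-↭ (↭-sym σcovers) (Unique.allFin⁺ k))
                                      (≡.trans (↭.↭-length πcovers) (sym (↭.↭-length σcovers)))
    = h , λ u → blocks-intertwine {h = h} {π} {σ} bs cs types πvalid σvalid hs (∈-resp-↭ (↭-sym πcovers) (∈-allFin u))

Step⇒lookup≡inject≤ : ∀ {n k} (k≤n : k ≤ n) {ρ : KPerm n k} {u u′} → Step ρ u u′ → lookup ρ u ≡ inject≤ u′ k≤n
Step⇒lookup≡inject≤ k≤n {u′ = u′} s = Fin.toℕ-injective (≡.trans s (sym (Fin.toℕ-inject≤ u′ k≤n)))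

module _ {n k} (k≤n : k ≤ n) {π σ : KPerm n k} (π-inj : IsKPerm π) (σ-inj : IsKPerm σ) where

  private
    embed : Fin k → Fin n
    embed u = inject≤ u k≤n

    embed-injective : ∀ {u v} → embed u ≡ embed v → u ≡ v
    embed-injective {u} {v} e = Fin.toℕ-injective
      (≡.trans (sym (Fin.toℕ-inject≤ u k≤n)) (≡.trans (cong toℕ e) (Fin.toℕ-inject≤ v k≤n)))

    embed-< : ∀ u → toℕ (embed u) < k
    embed-< u = subst (_< k) (sym (Fin.toℕ-inject≤ u k≤n)) (Fin.toℕ<n u)

  module _ {h : Permutation′ k} (intertwines : ∀ u → Intertwines h π σ u) where

    exits-intertwined : ∀ {u} → Exits π u → Exits σ (h ⟨$⟩ʳ u)
    exits-intertwined {u} e with intertwines u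
    ... | inj₁ (u′ , s , _) = ⊥-elim (ℕ.<⇒≱ (subst (_< k) (sym s) (Fin.toℕ<n u′)) e)
    ... | inj₂ (_ , e′)     = e′

    private
      exits? : ∀ u → Dec (Exits π u)
      exits? u = k ℕ.≤? toℕ (lookup π u)

      exits : List (Fin k)
      exits = filter exits? (allFin k)

      -- The prescribed values of the outer permutation: h on [k] ⊆ [n], and σ ∘ h ∘ π⁻¹ on the
      -- values where π leaves [k].
      domain image : List (Fin n)
      domain = map embed (allFin k) ++ map (lookup π) exits
      image  = map (embed ∘ (h ⟨$⟩ʳ_)) (allFin k) ++ map (lookup σ ∘ (h ⟨$⟩ʳ_)) exits

      disjoint : ∀ {ρ : KPerm n k} {f : Fin k → Fin n} {f′ : Fin k → Fin k} →
                 (∀ u → toℕ (f u) < k) → (∀ {u} → Exits π u → Exits ρ (f′ u)) →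
                 Disjoint (map f (allFin k)) (map (lookup ρ ∘ f′) exits)
      disjoint f<k exits⇒ (i∈ , j∈)
        with u , _ , refl ← ∈-map⁻ _ i∈
        with v , v∈ , e ← ∈-map⁻ _ j∈
        = ℕ.<⇒≱ (f<k u) (subst (λ j → k ≤ toℕ j) (sym e) (exits⇒ (proj₂ (∈-filter⁻ exits? {xs = allFin k} v∈))))

      domain! : Unique domain
      domain! = Unique.++⁺ (Unique.map⁺ embed-injective (Unique.allFin⁺ k))
                           (Unique.map⁺ (π-inj _ _) (Unique.filter⁺ exits? (Unique.allFin⁺ k)))
                           (disjoint {π} {f′ = λ u → u} embed-< (λ e → e))

      image! : Unique image
      image! = Unique.++⁺ (Unique.map⁺ (⟨$⟩ʳ-injective h ∘ embed-injective) (Unique.allFin⁺ k))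
                          (Unique.map⁺ (⟨$⟩ʳ-injective h ∘ σ-inj _ _) (Unique.filter⁺ exits? (Unique.allFin⁺ k)))
                          (disjoint {σ} {f′ = h ⟨$⟩ʳ_} (embed-< ∘ (h ⟨$⟩ʳ_)) exits-intertwined)

      length-map-++-map : ∀ (f g : Fin k → Fin n) → length (map f (allFin k) ++ map g exits) ≡ k ℕ.+ length exits
      length-map-++-map f g = ≡.trans (List.length-++ (map f (allFin k)))
        (cong₂ ℕ._+_ (≡.trans (List.length-map f (allFin k)) (List.length-tabulate (λ i → i))) (List.length-map g exits))

    outerPermutation : Σ (Permutation′ n) λ g → (∀ u → g ⟨$⟩ʳ embed u ≡ embed (h ⟨$⟩ʳ u))
                                              × (∀ {u} → Exits π u → g ⟨$⟩ʳ lookup π u ≡ lookup σ (h ⟨$⟩ʳ u))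
    outerPermutation
      with g , gs ← extendToPermutation domain! image! (≡.trans (length-map-++-map _ _) (sym (length-map-++-map _ _)))
      with gs-embed , gs-exits ← Pointwise-++⁻ (≡.trans (List.length-map _ (allFin k)) (sym (List.length-map _ (allFin k)))) gs
      = g , (λ u → Pointwise-map⇒∈ gs-embed (∈-allFin u))
          , (λ {u} e → Pointwise-map⇒∈ gs-exits (∈-filter⁺ exits? (∈-allFin u) e))

    relabelling : Σ (Relabelling n k) λ r → relabel r π ≡ σ
    relabelling = r , Vec-ext λ i → begin
      lookup (relabel r π) i             ≡⟨ lookup-relabel r π i ⟩
      g ⟨$⟩ʳ lookup π (h ⟨$⟩ˡ i)          ≡⟨ g∘π≡σ∘h (h ⟨$⟩ˡ i) ⟩
      lookup σ (h ⟨$⟩ʳ (h ⟨$⟩ˡ i))        ≡⟨ cong (lookup σ) (inverseʳ h) ⟩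
      lookup σ i                         ∎
      where
      open ≡-Reasoning
      g = proj₁ outerPermutation
      g∘embed≡embed∘h = proj₁ (proj₂ outerPermutation)
      g∘π≡σ∘h-on-exits = proj₂ (proj₂ outerPermutation)

      r : Relabelling n k
      r = record { outer = g ; inner = h ; restricts = restricts′ }
        where
        restricts′ : ∀ i x → toℕ i ≡ toℕ x → toℕ (g ⟨$⟩ʳ i) ≡ toℕ (h ⟨$⟩ʳ x)
        restricts′ i x i≈x = begin
          toℕ (g ⟨$⟩ʳ i)           ≡⟨ cong (λ j → toℕ (g ⟨$⟩ʳ j)) (Fin.toℕ-injective (≡.trans i≈x (sym (Fin.toℕ-inject≤ x k≤n)))) ⟩
          toℕ (g ⟨$⟩ʳ embed x)     ≡⟨ cong toℕ (g∘embed≡embed∘h x) ⟩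
          toℕ (embed (h ⟨$⟩ʳ x))   ≡⟨ Fin.toℕ-inject≤ _ k≤n ⟩
          toℕ (h ⟨$⟩ʳ x)           ∎

      g∘π≡σ∘h : ∀ u → g ⟨$⟩ʳ lookup π u ≡ lookup σ (h ⟨$⟩ʳ u)
      g∘π≡σ∘h u with k ℕ.≤? toℕ (lookup π u) | intertwines u
      ... | yes exit | _                    = g∘π≡σ∘h-on-exits exit
      ... | no stays | inj₂ (exit , _)      = ⊥-elim (stays exit)
      ... | no _     | inj₁ (u′ , πu , σhu) = begin
        g ⟨$⟩ʳ lookup π u     ≡⟨ cong (g ⟨$⟩ʳ_) (Step⇒lookup≡inject≤ k≤n {π} πu) ⟩
        g ⟨$⟩ʳ embed u′       ≡⟨ g∘embed≡embed∘h u′ ⟩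
        embed (h ⟨$⟩ʳ u′)     ≡⟨ Step⇒lookup≡inject≤ k≤n {σ} σhu ⟨
        lookup σ (h ⟨$⟩ʳ u)   ∎

sameCycleType⇒relabelling : ∀ {n k} → k ≤ n → {π σ : KPerm n k} → IsKPerm π → IsKPerm σ → SameCycleType π σ →
                             Σ (Relabelling n k) λ r → relabel r π ≡ σ
sameCycleType⇒relabelling k≤n {π} {σ} π-inj σ-inj ((bs , dπ) , (cs , dσ) , types)
  with bs′ , types≡ , bs↭bs′ ← ↭.↭-map-inv (λ b → kind b , L⁺.length (elems b)) types
  with h , intertwines ← innerMatching {π = π} {σ} (IsDecomposition-resp-↭ bs↭bs′ dπ) dσ (sym types≡)
  = relabelling k≤n {π} {σ} π-inj σ-inj {h} intertwines

theorem6 : (n k : ℕ) → 1 ≤ k → k ≤ n → CycleTypePartitionEquitable n k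
theorem6 n k _ k≤n π σ τ π-inj σ-inj _ same
  with r , π↦σ ← sameCycleType⇒relabelling k≤n {π} {σ} π-inj σ-inj same
  with m , neighbours ← neighboursInClass π τ
  = m , neighbours , subst (λ ρ → NeighboursInClass ρ τ m) π↦σ (neighboursInClass-relabel k≤n r {π} neighbours)
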